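{- Let $a,b,c,m$ be positive integers with $a\neq 1$, $m\neq 1$ and $b\ge m-1-c$. Then for every positive integer $n$, the value \[\left\lfloor \frac{\log_a(a^m n+t)-c}{b}\right\rfloor\] is the same for all integers $t$ with $a^{m-1}\le t\le a^m-1$; that is, \[\left\lfloor \frac{\log_a(a^{m}n+a^{m-1})-c}{b}\right\rfloor=\left\lfloor \frac{\log_a(a^{m}n+a^{m-1}+1)-c}{b}\right\rfloor=\cdots=\left\lfloor \frac{\log_a(a^{m}n+a^{m}-1)-c}{b}\right\rfloor .\]
   Context: $\lfloor y\rfloor$ denotes the greatest integer less than or equal to $y$; $\log_a$ is the logarithm to base $a$. -}

module Defs where

open import Data.Nat using (ℕ; suc; _^_; _*_; _≤_; _<_)
open import Data.Integer using (ℤ; +_; -[1+_]; 1ℤ) renaming (_+_ to _+ℤ_; _*_ to _*ℤ_)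
open import Data.Product using (_×_)

-- PowLe a e x  means  a^e ≤ x  (as rationals), for an integer exponent e.
PowLe : ℕ → ℤ → ℕ → Set
PowLe a (+ n) x = a ^ n ≤ x
PowLe a -[1+ n ] x = 1 ≤ x * a ^ suc n

-- LtPow a e x  means  x < a^e  (as rationals), for an integer exponent e.
LtPow : ℕ → ℤ → ℕ → Set
LtPow a (+ n) x = x < a ^ n
LtPow a -[1+ n ] x = x * a ^ suc n < 1

-- IsFloorLogQuot a b c x k  means  k = ⌊ (log_a x − c) / b ⌋  (for a > 1, b > 0, x > 0),
-- i.e.  k ≤ (log_a x − c)/b < k + 1,  i.e.  a^(b k + c) ≤ x < a^(b (k+1) + c).
IsFloorLogQuot : ℕ → ℕ → ℕ → ℕ → ℤ → Set
IsFloorLogQuot a b c x k =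
  PowLe a ((+ b) *ℤ k +ℤ (+ c)) x × LtPow a ((+ b) *ℤ (k +ℤ 1ℤ) +ℤ (+ c)) x

{-# OPTIONS --safe #-}
module Submission where

-- The floor ⌊(log_a x − c)/b⌋ depends only on E = ⌊log_a x⌋, so it is constant on the block.

open import Data.Nat using (ℕ; _+_; _*_; _^_; _∸_; _≤_; _<_)
open import Data.Integer using (ℤ)
open import Data.Product using (∃)
open import Relation.Binary.PropositionalEquality using (_≢_)
open import Defs

open import Data.Nat using (suc; z≤n; s≤s; NonZero; >-nonZero; _<?_)
open import Data.Nat.Properties
open import Data.Integer using (+_; -[1+_]; +≤+; +<+; 1ℤ) renaming (_+_ to _+ℤ_; _-_ to _-ℤ_; _*_ to _*ℤ_)
import Data.Integer as ℤ
import Data.Integer.Properties as ℤ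
open import Data.Integer.DivMod using (_/ℕ_; [n/ℕd]*d≤n; n<s[n/ℕd]*d)
open import Data.Product using (_,_; _×_; Σ)
open import Function using (_∘_)
open import Relation.Binary.PropositionalEquality using (_≡_; sym; cong; subst; subst₂; module ≡-Reasoning)
open import Relation.Nullary using (yes; no)

floorLog : ∀ a → 1 < a → ∀ x → 1 ≤ x → ∃ λ E → a ^ E ≤ x × x < a ^ suc E
floorLog a 1<a 1 _ = 0 , ≤-refl , subst (1 <_) (sym (*-identityʳ a)) 1<a
floorLog a 1<a (suc x@(suc _)) _ with floorLog a 1<a x (s≤s z≤n)
... | E , a^E≤x , x<a^E⁺ with suc x <? a ^ suc E
...   | yes 1+x<a^E⁺ = E , m≤n⇒m≤1+n a^E≤x , 1+x<a^E⁺
...   | no  1+x≮a^E⁺ = suc E , ≤-reflexive (sym 1+x≡a^E⁺) , 1+x<a^E⁺⁺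
  where
  1+x≡a^E⁺ : suc x ≡ a ^ suc E
  1+x≡a^E⁺ = ≤-antisym x<a^E⁺ (≮⇒≥ 1+x≮a^E⁺)
  1+x<a^E⁺⁺ : suc x < a ^ suc (suc E)
  1+x<a^E⁺⁺ = subst (_< a ^ suc (suc E)) (sym 1+x≡a^E⁺) (^-monoʳ-< a 1<a (n<1+n (suc E)))

^-cancelʳ-< : ∀ a .{{_ : NonZero a}} {m n} → a ^ m < a ^ n → m < n
^-cancelʳ-< a a^m<a^n = ≰⇒> (<⇒≱ a^m<a^n ∘ ^-monoʳ-≤ a)

a^m*n<a^e⇒a^m*[1+n]≤a^e : ∀ a .{{_ : NonZero a}} m n e → 1 ≤ n →
                          a ^ m * n < a ^ e → a ^ m * suc n ≤ a ^ e
a^m*n<a^e⇒a^m*[1+n]≤a^e a m n e 1≤n a^m*n<a^e =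
  subst (a ^ m * suc n ≤_) (sym a^e≡a^m*a^d) (*-monoʳ-≤ (a ^ m) n<a^d)
  where
  m<e : m < e
  m<e = ^-cancelʳ-< a (≤-<-trans (m≤m*n (a ^ m) n {{>-nonZero 1≤n}}) a^m*n<a^e)
  d : ℕ
  d = e ∸ m
  a^e≡a^m*a^d : a ^ e ≡ a ^ m * a ^ d
  a^e≡a^m*a^d = subst (λ i → a ^ i ≡ a ^ m * a ^ d) (m+[n∸m]≡n (<⇒≤ m<e)) (^-distribˡ-+-* a m d)
  n<a^d : n < a ^ d
  n<a^d = *-cancelˡ-< (a ^ m) n (a ^ d) (subst (a ^ m * n <_) a^e≡a^m*a^d a^m*n<a^e)

floorQuotient : ∀ (z w : ℤ) b .{{_ : NonZero b}} →
                Σ ℤ λ k → (+ b) *ℤ k +ℤ w ℤ.≤ z × z ℤ.< (+ b) *ℤ (k +ℤ 1ℤ) +ℤ w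
floorQuotient z w b = k , lower , upper
  where
  open ≡-Reasoning
  k : ℤ
  k = (z -ℤ w) /ℕ b
  z-w+w≡z : (z -ℤ w) +ℤ w ≡ z
  z-w+w≡z = begin
    (z -ℤ w) +ℤ w       ≡⟨ ℤ.+-assoc z (ℤ.- w) w ⟩
    z +ℤ (ℤ.- w +ℤ w)   ≡⟨ cong (z +ℤ_) (ℤ.+-inverseˡ w) ⟩
    z +ℤ + 0            ≡⟨ ℤ.+-identityʳ z ⟩
    z                   ∎
  [1+k]*b≡b*[k+1] : ℤ.suc k *ℤ + b ≡ (+ b) *ℤ (k +ℤ 1ℤ)
  [1+k]*b≡b*[k+1] = begin
    ℤ.suc k *ℤ + b      ≡⟨ ℤ.*-comm (ℤ.suc k) (+ b) ⟩
    + b *ℤ (1ℤ +ℤ k)    ≡⟨ cong (+ b *ℤ_) (ℤ.+-comm 1ℤ k) ⟩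
    + b *ℤ (k +ℤ 1ℤ)    ∎
  lower : (+ b) *ℤ k +ℤ w ℤ.≤ z
  lower = subst₂ ℤ._≤_ (cong (_+ℤ w) (ℤ.*-comm k (+ b))) z-w+w≡z
                 (ℤ.+-monoˡ-≤ w ([n/ℕd]*d≤n (z -ℤ w) b))
  upper : z ℤ.< (+ b) *ℤ (k +ℤ 1ℤ) +ℤ w
  upper = subst₂ ℤ._<_ z-w+w≡z (cong (_+ℤ w) [1+k]*b≡b*[k+1])
                 (ℤ.+-monoˡ-< w (n<s[n/ℕd]*d (z -ℤ w) b))

PowLe-≤ : ∀ a .{{_ : NonZero a}} E x → a ^ E ≤ x → ∀ e → e ℤ.≤ + E → PowLe a e x
PowLe-≤ a E x a^E≤x (+ n) (+≤+ n≤E) = ≤-trans (^-monoʳ-≤ a n≤E) a^E≤x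
PowLe-≤ a E x a^E≤x -[1+ n ] _ = *-mono-≤ (≤-trans (m^n>0 a E) a^E≤x) (m^n>0 a (suc n))

LtPow-< : ∀ a .{{_ : NonZero a}} E x → x < a ^ suc E → ∀ e → + E ℤ.< e → LtPow a e x
LtPow-< a E x x<a^E⁺ (+ n) (+<+ E<n) = <-≤-trans x<a^E⁺ (^-monoʳ-≤ a E<n)

isFloorLogQuot : ∀ a b c .{{_ : NonZero a}} E x k → a ^ E ≤ x → x < a ^ suc E →
                 (+ b) *ℤ k +ℤ + c ℤ.≤ + E → + E ℤ.< (+ b) *ℤ (k +ℤ 1ℤ) +ℤ + c →
                 IsFloorLogQuot a b c x k
isFloorLogQuot a b c E x k a^E≤x x<a^E⁺ lower upper =
  PowLe-≤ a E x a^E≤x _ lower , LtPow-< a E x x<a^E⁺ _ upper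

isFloorLogQuot-block : ∀ a b c .{{_ : NonZero a}} m n E k → 1 ≤ n →
                       a ^ E ≤ a ^ m * n → a ^ m * n < a ^ suc E →
                       (+ b) *ℤ k +ℤ + c ℤ.≤ + E → + E ℤ.< (+ b) *ℤ (k +ℤ 1ℤ) +ℤ + c →
                       ∀ t → t < a ^ m → IsFloorLogQuot a b c (a ^ m * n + t) k
isFloorLogQuot-block a b c m n E k 1≤n a^E≤a^m*n a^m*n<a^E⁺ lower upper t t<a^m =
  isFloorLogQuot a b c E (a ^ m * n + t) k (≤-trans a^E≤a^m*n (m≤m+n _ t)) x<a^E⁺ lower upper
  where
  open ≤-Reasoning
  x<a^E⁺ : a ^ m * n + t < a ^ suc E
  x<a^E⁺ = begin-strict
    a ^ m * n + t     <⟨ +-monoʳ-< (a ^ m * n) t<a^m ⟩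
    a ^ m * n + a ^ m ≡⟨ +-comm (a ^ m * n) (a ^ m) ⟩
    a ^ m + a ^ m * n ≡⟨ *-suc (a ^ m) n ⟨
    a ^ m * suc n     ≤⟨ a^m*n<a^e⇒a^m*[1+n]≤a^e a m n (suc E) 1≤n a^m*n<a^E⁺ ⟩
    a ^ suc E         ∎

floorLogQuot-constant-on-block : ∀ a b c m n .{{_ : NonZero b}} → 1 < a → 1 ≤ n →
                                 ∃ λ k → ∀ t → t < a ^ m → IsFloorLogQuot a b c (a ^ m * n + t) k
floorLogQuot-constant-on-block a@(suc _) b c m n 1<a 1≤n
  with E , a^E≤a^m*n , a^m*n<a^E⁺ ← floorLog a 1<a (a ^ m * n) (*-mono-≤ (m^n>0 a m) 1≤n)
  with k , lower , upper ← floorQuotient (+ E) (+ c) b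
  = k , isFloorLogQuot-block a b c m n E k 1≤n a^E≤a^m*n a^m*n<a^E⁺ lower upper

corollary9 : (a b c m : ℕ) → 1 ≤ a → 1 ≤ b → 1 ≤ c → 1 ≤ m → a ≢ 1 → m ≢ 1 → m ≤ b + c + 1 →
    (n : ℕ) → 1 ≤ n →
    ∃ λ (k : ℤ) → (t : ℕ) → a ^ (m ∸ 1) ≤ t → t ≤ a ^ m ∸ 1 →
    IsFloorLogQuot a b c (a ^ m * n + t) k
corollary9 a b c m 1≤a 1≤b _ _ a≢1 _ _ n 1≤n
  with k , onBlock ← floorLogQuot-constant-on-block a b c m n {{>-nonZero 1≤b}} (≤∧≢⇒< 1≤a (a≢1 ∘ sym)) 1≤n
  = k , λ t _ t≤a^m-1 → onBlock t (m≤pred[n]⇒suc[m]≤n {{m^n≢0 a m {{>-nonZero 1≤a}}}} t≤a^m-1)
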